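{- Let $\phi$ be an LTL formula in the class on which $ofp$ is defined (see context), and let $S=\{l\in[ofp(\phi)]\mid l.duration=\ge\}$. Then $\phi$ is unsatisfiable if at least one of the following holds: (1) there exists $l\in[ofp(\phi)]$ with $l.start=i\in\mathbb{N}$ such that $ofp(\phi)\!\downarrow_i\equiv\mathit{ff}$; (2) $ofp(\phi)\!\downarrow_S\equiv\mathit{ff}$; (3) there exist $l\in[ofp(\phi)]$ with $l.start=\star$ and a subset $S'\subseteq S$ all of whose elements $l'$ satisfy $l'.start=0$, such that $ofp(\phi)\!\downarrow_{S'\cup\{l\}}\equiv\mathit{ff}$; (4) there exists $l\in[ofp(\phi)]$ with $l.duration=\inf$ such that $ofp(\phi)\!\downarrow_{S\cup\{l\}}\equiv\mathit{ff}$.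
   Context: Let $AP$ be a finite set of atomic propositions; a literal is $a$ or $\neg a$ with $a\in AP$. Consider LTL formulas generated by $\phi::=p\mid\phi\wedge\phi\mid\phi\vee\phi\mid X\phi\mid\phi U\phi\mid\phi R\phi\mid G\phi$, where $p$ is a literal. The left arguments of $U$ and $R$ may be arbitrary LTL formulas (e.g. $F\psi=\mathit{tt}U\psi$). Standard LTL semantics over infinite words in $(2^{AP})^\omega$ apply; $\phi$ is unsatisfiable if no word satisfies it. A positional literal is a triple $l=\langle p,s,d\rangle$ with $l.prop=p$ a literal, $l.start=s\in\mathbb{N}\cup\{\star\}$ and $l.duration=d\in\{\mathrm{cur},\inf,\ge\}$. The formula $ofp(\phi)$ is a positive Boolean combination of positional literals; $[ofp(\phi)]$ is the set of positional literals occurring in it. It is defined recursively: - $ofp(p)=\langle p,0,\mathrm{cur}\rangle$; - $ofp(\phi_1\wedge\phi_2)=ofp(\phi_1)\wedge ofp(\phi_2)$; - $ofp(\phi_1\vee\phi_2)=ofp(\phi_1)\vee ofp(\phi_2)$ if all positional literals in $[ofp(\phi_1)]\cup[ofp(\phi_2)]$ have the same start (where $\star$ equals $\star$). Otherwise $ofp(\phi_1\vee\phi_2)=ofp(\phi_1)'\vee ofp(\phi_2)'$, where $'$ replaces every $\langle p,s,d\rangle$ by $\langle p,\star,\mathrm{cur}\rangle$; - $ofp(X\psi)=Pos(ofp(\psi),X)$; - $ofp(\phi_1U\phi_2)=Pos(ofp(\phi_2),U)$; - $ofp(\phi_1R\phi_2)=Pos(ofp(\phi_2),R)$; - $ofp(G\psi)=Pos(ofp(\psi),G)$.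 $Pos(t,\mathit{type})$ replaces each positional literal of $t$, keeping the Boolean structure, according to the following rules, where $i\in\mathbb{N}$: - $\langle p,i,\mathrm{cur}\rangle$ becomes $\langle p,i+1,\mathrm{cur}\rangle$ under X, $\langle p,\star,\mathrm{cur}\rangle$ under U, $\langle p,i,\mathrm{cur}\rangle$ under R, and $\langle p,i,\ge\rangle$ under G; - $\langle p,\star,\mathrm{cur}\rangle$ stays $\langle p,\star,\mathrm{cur}\rangle$ under X, U and R, and becomes $\langle p,\star,\inf\rangle$ under G; - $\langle p,i,\ge\rangle$ becomes $\langle p,i+1,\ge\rangle$ under X, $\langle p,\star,\ge\rangle$ under U, and stays $\langle p,i,\ge\rangle$ under R and G; - $\langle p,\star,\ge\rangle$ is unchanged under X, U, R and G; - $\langle p,i,\inf\rangle$ becomes $\langle p,i+1,\inf\rangle$ under X, $\langle p,\star,\inf\rangle$ under U, and stays $\langle p,i,\inf\rangle$ under R and G; - $\langle p,\star,\inf\rangle$ is unchanged under X, U, R and G. Positional projection $ofp(\phi)\!\downarrow_i$, for $i\in\mathbb{N}$, replaces each positional literal $l$ by $l.prop$ if $l.start=i$, or if $l.start\in\mathbb{N}$, $l.start<i$ and $l.duration=\ge$. Otherwise it replaces $l$ by $\mathit{tt}$. $\wedge$ and $\vee$ are preserved. Abstract projection $ofp(\phi)\!\downarrow_T$, for a set $T$ of positional literals, replaces each positional literal $l$ by $l.prop$ if $l\in T$ and by $\mathit{tt}$ otherwise, preserving $\wedge,\vee$. Both projections are propositional formulas over $AP$, and $\equiv\mathit{ff}$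 means propositionally unsatisfiable. -}

module Defs where

open import Data.Nat using (ℕ; zero; suc; _≤_; _<_)
open import Data.Nat.Properties using (_<?_)
open import Data.Fin using (Fin)
import Data.Fin as F
import Data.Nat as N
open import Data.Bool using (Bool; true; false; _∧_; _∨_; not; if_then_else_)
open import Data.List using (List; []; _∷_; _++_)
open import Data.Product using (Σ; _×_; ∃)
open import Data.Sum using (_⊎_)
open import Data.Empty using (⊥)
open import Relation.Nullary using (¬_)
open import Relation.Nullary.Decidable using (⌊_⌋)
open import Relation.Binary.PropositionalEquality using (_≡_)
open import Data.List.Membership.Propositional using (_∈_)

-- Atomic propositions: AP = Fin n (an arbitrary finite set)

module _ (n : ℕ) where

  data Lit : Set where
    pos : Fin n → Lit
    neg : Fin n → Lit

  -- General LTL (used for the left arguments of U and R, which may be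
  -- arbitrary LTL formulas, e.g. tt in F ψ = tt U ψ)
  data LTL : Set where
    ltt ltff : LTL
    llit : Lit → LTL
    lnot : LTL → LTL
    land lor : LTL → LTL → LTL
    lX lG lF : LTL → LTL
    lU lR : LTL → LTL → LTL

  data Frag : Set where
    lit : Lit → Frag
    _∧ᶠ_ _∨ᶠ_ : Frag → Frag → Frag
    X G : Frag → Frag
    U R : LTL → Frag → Frag

embed : ∀ {n} → Frag n → LTL n
embed (lit p) = llit p
embed (φ ∧ᶠ ψ) = land (embed φ) (embed ψ)
embed (φ ∨ᶠ ψ) = lor (embed φ) (embed ψ)
embed (X φ) = lX (embed φ)
embed (G φ) = lG (embed φ)
embed (U ψ φ) = lU ψ (embed φ)
embed (R ψ φ) = lR ψ (embed φ)

Word : ℕ → Set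
Word n = ℕ → Fin n → Bool

satLit : ∀ {n} → Word n → ℕ → Lit n → Set
satLit w i (pos a) = w i a ≡ true
satLit w i (neg a) = w i a ≡ false

Sat : ∀ {n} → Word n → ℕ → LTL n → Set
Sat w i ltt = Data.Unit.⊤ where import Data.Unit
Sat w i ltff = ⊥
Sat w i (llit p) = satLit w i p
Sat w i (lnot φ) = ¬ Sat w i φ
Sat w i (land φ ψ) = Sat w i φ × Sat w i ψ
Sat w i (lor φ ψ) = Sat w i φ ⊎ Sat w i ψ
Sat w i (lX φ) = Sat w (suc i) φ
Sat w i (lG φ) = ∀ k → i ≤ k → Sat w k φ
Sat w i (lF φ) = Σ ℕ λ k → i ≤ k × Sat w k φ
Sat w i (lU φ ψ) =
  Σ ℕ λ k → i ≤ k × Sat w k ψ × (∀ j → i ≤ j → j < k → Sat w j φ)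
Sat w i (lR φ ψ) =
  ∀ k → i ≤ k → Sat w k ψ ⊎ (Σ ℕ λ j → i ≤ j × j < k × Sat w j φ)

Satisfiable : ∀ {n} → LTL n → Set
Satisfiable {n} φ = Σ (Word n) λ w → Sat w 0 φ

Unsatisfiable : ∀ {n} → LTL n → Set
Unsatisfiable φ = ¬ Satisfiable φ

data PB (A : Set) : Set where
  atom : A → PB A
  pand por : PB A → PB A → PB A

mapPB : ∀ {A B : Set} → (A → B) → PB A → PB B
mapPB f (atom a) = atom (f a)
mapPB f (pand s t) = pand (mapPB f s) (mapPB f t)
mapPB f (por s t) = por (mapPB f s) (mapPB f t)

leaves : ∀ {A : Set} → PB A → List A
leaves (atom a) = a ∷ []
leaves (pand s t) = leaves s ++ leaves t
leaves (por s t) = leaves s ++ leaves t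

data Start : Set where
  num : ℕ → Start
  star : Start

data Duration : Set where
  cur inf ge : Duration     -- ge stands for "≥"

record PosLit (n : ℕ) : Set where
  constructor ⟨_,_,_⟩
  field
    prop : Lit n
    start : Start
    duration : Duration
open PosLit public

eqStart : Start → Start → Bool
eqStart (num i) (num j) = ⌊ i N.≟ j ⌋
eqStart star star = true
eqStart _ _ = false

eqDur : Duration → Duration → Bool
eqDur cur cur = true
eqDur inf inf = true
eqDur ge ge = true
eqDur _ _ = false

eqLit : ∀ {n} → Lit n → Lit n → Bool
eqLit (pos a) (pos b) = ⌊ a F.≟ b ⌋
eqLit (neg a) (neg b) = ⌊ a F.≟ b ⌋
eqLit _ _ = false

eqPosLit : ∀ {n} → PosLit n → PosLit n → Bool
eqPosLit l l' = eqLit (prop l) (prop l') ∧ eqStart (start l) (start l')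
                ∧ eqDur (duration l) (duration l')

allB : ∀ {A : Set} → (A → Bool) → List A → Bool
allB P [] = true
allB P (x ∷ xs) = P x ∧ allB P xs

allSameStart : ∀ {n} → List (PosLit n) → Bool
allSameStart [] = true
allSameStart (l ∷ ls) = allB (λ l' → eqStart (start l) (start l')) ls

data OpType : Set where
  tyX tyU tyR tyG : OpType

posLit : ∀ {n} → OpType → PosLit n → PosLit n
posLit tyX ⟨ p , num i , cur ⟩ = ⟨ p , num (suc i) , cur ⟩
posLit tyU ⟨ p , num i , cur ⟩ = ⟨ p , star , cur ⟩
posLit tyR ⟨ p , num i , cur ⟩ = ⟨ p , num i , cur ⟩
posLit tyG ⟨ p , num i , cur ⟩ = ⟨ p , num i , ge ⟩
posLit tyG ⟨ p , star , cur ⟩ = ⟨ p , star , inf ⟩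
posLit _   ⟨ p , star , cur ⟩ = ⟨ p , star , cur ⟩
posLit tyX ⟨ p , num i , ge ⟩ = ⟨ p , num (suc i) , ge ⟩
posLit tyU ⟨ p , num i , ge ⟩ = ⟨ p , star , ge ⟩
posLit _   ⟨ p , num i , ge ⟩ = ⟨ p , num i , ge ⟩
posLit _   ⟨ p , star , ge ⟩ = ⟨ p , star , ge ⟩
posLit tyX ⟨ p , num i , inf ⟩ = ⟨ p , num (suc i) , inf ⟩
posLit tyU ⟨ p , num i , inf ⟩ = ⟨ p , star , inf ⟩
posLit _   ⟨ p , num i , inf ⟩ = ⟨ p , num i , inf ⟩
posLit _   ⟨ p , star , inf ⟩ = ⟨ p , star , inf ⟩

Pos : ∀ {n} → PB (PosLit n) → OpType → PB (PosLit n)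
Pos t ty = mapPB (posLit ty) t

starCur : ∀ {n} → PosLit n → PosLit n
starCur l = ⟨ prop l , star , cur ⟩

ofp : ∀ {n} → Frag n → PB (PosLit n)
ofp (lit p) = atom ⟨ p , num 0 , cur ⟩
ofp (φ₁ ∧ᶠ φ₂) = pand (ofp φ₁) (ofp φ₂)
ofp (φ₁ ∨ᶠ φ₂) =
  if allSameStart (leaves (ofp φ₁) ++ leaves (ofp φ₂))
  then por (ofp φ₁) (ofp φ₂)
  else por (mapPB starCur (ofp φ₁)) (mapPB starCur (ofp φ₂))
ofp (X ψ) = Pos (ofp ψ) tyX
ofp (U φ₁ φ₂) = Pos (ofp φ₂) tyU
ofp (R φ₁ φ₂) = Pos (ofp φ₂) tyR
ofp (G ψ) = Pos (ofp ψ) tyG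

data Prop (n : ℕ) : Set where
  ptt : Prop n
  plit : Lit n → Prop n
  pand por : Prop n → Prop n → Prop n

evalLit : ∀ {n} → (Fin n → Bool) → Lit n → Bool
evalLit v (pos a) = v a
evalLit v (neg a) = not (v a)

evalP : ∀ {n} → (Fin n → Bool) → Prop n → Bool
evalP v ptt = true
evalP v (plit p) = evalLit v p
evalP v (pand f g) = evalP v f ∧ evalP v g
evalP v (por f g) = evalP v f ∨ evalP v g

IsFF : ∀ {n} → Prop n → Set
IsFF {n} f = ∀ (v : Fin n → Bool) → evalP v f ≡ false

projPB : ∀ {n} → (PosLit n → Prop n) → PB (PosLit n) → Prop n
projPB f (atom l) = f l
projPB f (pand s t) = pand (projPB f s) (projPB f t)
projPB f (por s t) = por (projPB f s) (projPB f t)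

keepAt : ∀ {n} → ℕ → PosLit n → Bool
keepAt i ⟨ p , num s , d ⟩ = ⌊ s N.≟ i ⌋ ∨ (⌊ s <? i ⌋ ∧ eqDur d ge)
keepAt i ⟨ p , star , d ⟩ = false

projAt : ∀ {n} → PB (PosLit n) → ℕ → Prop n
projAt t i = projPB (λ l → if keepAt i l then plit (prop l) else ptt) t

projSet : ∀ {n} → PB (PosLit n) → (PosLit n → Bool) → Prop n
projSet t T = projPB (λ l → if T l then plit (prop l) else ptt) t

-- S = { l ∈ [ofp φ] | l.duration = ≥ }  (as a predicate; projection only
-- inspects literals of ofp φ, which lie in [ofp φ])
inS : ∀ {n} → PosLit n → Bool
inS l = eqDur (duration l) ge

Cond1 : ∀ {n} → Frag n → Set
Cond1 φ = Σ _ λ l → l ∈ leaves (ofp φ) ×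
            Σ ℕ λ i → start l ≡ num i × IsFF (projAt (ofp φ) i)

Cond2 : ∀ {n} → Frag n → Set
Cond2 φ = IsFF (projSet (ofp φ) inS)

Cond3 : ∀ {n} → Frag n → Set
Cond3 {n} φ = Σ (PosLit n) λ l → l ∈ leaves (ofp φ) × start l ≡ star ×
  Σ (PosLit n → Bool) λ S' →
    (∀ l' → S' l' ≡ true → (l' ∈ leaves (ofp φ) × duration l' ≡ ge) × start l' ≡ num 0) ×
    IsFF (projSet (ofp φ) (λ l' → S' l' ∨ eqPosLit l' l))

Cond4 : ∀ {n} → Frag n → Set
Cond4 φ = Σ _ λ l → l ∈ leaves (ofp φ) × duration l ≡ inf ×
  IsFF (projSet (ofp φ) (λ l' → inS l' ∨ eqPosLit l' l))

-- By induction on φ one finds a threshold N₀ such that at EVERY position N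
-- the positive combination ofp(φ) is true once each positional literal l is read as "if l is due at
-- N then l.prop holds at N": ⟨p,i,cur⟩ is due exactly at N = i, ⟨p,i,≥⟩ from i on, ⟨p,⋆,≥⟩ from N₀
-- on, ⟨p,s,inf⟩ also wherever p holds only finitely often, and a literal that never holds again may
-- be read as due anywhere, since the satisfying branch cannot rely on it. Each of the four conditions
-- then names a position N at which every literal kept by the projection is due (or holds anyway); the
-- projection is then true at w(N), contradicting ≡ ff. For (3) and (4) the position depends on whether
-- l.prop holds somewhere, resp. infinitely often; as the goal is ⊥ these case distinctions are
-- available constructively.
module Submission where

open import Defs
open import Data.Nat using (ℕ; suc; _+_; _∸_; _≤_; _⊔_; z≤n; s≤s; _≤?_; _≟_)
open import Data.Nat.Properties
  using (≤-refl; ≤-trans; ≤-reflexive; <⇒≤; <⇒≱; n≤1+n; +-suc; +-identityʳ; m≤m+n; m≤n+m;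
         m≤m⊔n; m≤n⊔m; +-monoʳ-≤; m∸n+n≡m; m+n≤o⇒m≤o∸n; m+n≤o⇒m≤o; m+n≤o⇒n≤o; _<?_)
open import Data.Fin using (Fin) renaming (_≟_ to _≟ᶠ_)
open import Data.Bool using (Bool; true; false; T; _∧_; _∨_; not; if_then_else_)
open import Data.Bool.Properties using (T-≡; T-∧; T-∨; ∨-zeroʳ)
open import Data.Empty using (⊥; ⊥-elim)
open import Data.Product using (∃; _×_; _,_; proj₁; proj₂)
open import Data.Sum using (_⊎_; inj₁; inj₂; [_,_])
import Data.Sum as Sum
open import Data.List using (List; []; _∷_; _++_)
import Data.List as List
open import Data.List.Properties using (map-++)
open import Data.List.Membership.Propositional using (_∈_)
open import Data.List.Membership.Propositional.Properties using (∈-++⁺ˡ; ∈-++⁺ʳ; ∈-++⁻; ∈-map⁺; ∈-map⁻)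
open import Data.List.Relation.Unary.Any using (here; there)
import Data.List.Relation.Unary.All as All
open import Data.List.Extrema.Nat using (max; xs≤max)
open import Function using (_∘_; id)
open import Function.Bundles using (Equivalence)
open import Relation.Nullary using (¬_; yes; no; contradiction)
open import Relation.Nullary.Decidable using (toWitness; ¬¬-excluded-middle)
open import Relation.Binary.PropositionalEquality
  using (_≡_; refl; sym; trans; cong; cong₂; subst)

open Equivalence using (to; from)

private
  variable
    n : ℕ
    A B : Set

⟦_⟧ : PB A → (A → Set) → Set
⟦ atom a ⟧ P = P a
⟦ pand s t ⟧ P = ⟦ s ⟧ P × ⟦ t ⟧ P
⟦ por s t ⟧ P = ⟦ s ⟧ P ⊎ ⟦ t ⟧ P

⟦⟧-mono : ∀ {P Q : A → Set} t → (∀ {a} → a ∈ leaves t → P a → Q a) → ⟦ t ⟧ P → ⟦ t ⟧ Q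
⟦⟧-mono (atom a) f = f (here refl)
⟦⟧-mono (pand s t) f (x , y) = ⟦⟧-mono s (f ∘ ∈-++⁺ˡ) x , ⟦⟧-mono t (f ∘ ∈-++⁺ʳ (leaves s)) y
⟦⟧-mono (por s t) f = Sum.map (⟦⟧-mono s (f ∘ ∈-++⁺ˡ)) (⟦⟧-mono t (f ∘ ∈-++⁺ʳ (leaves s)))

⟦⟧-mapPB : ∀ {P : B → Set} (g : A → B) t → ⟦ t ⟧ (P ∘ g) → ⟦ mapPB g t ⟧ P
⟦⟧-mapPB g (atom a) x = x
⟦⟧-mapPB g (pand s t) (x , y) = ⟦⟧-mapPB g s x , ⟦⟧-mapPB g t y
⟦⟧-mapPB g (por s t) = Sum.map (⟦⟧-mapPB g s) (⟦⟧-mapPB g t)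

leaves-mapPB : (g : A → B) (t : PB A) → leaves (mapPB g t) ≡ List.map g (leaves t)
leaves-mapPB g (atom a) = refl
leaves-mapPB g (pand s t) =
  trans (cong₂ _++_ (leaves-mapPB g s) (leaves-mapPB g t)) (sym (map-++ g (leaves s) (leaves t)))
leaves-mapPB g (por s t) =
  trans (cong₂ _++_ (leaves-mapPB g s) (leaves-mapPB g t)) (sym (map-++ g (leaves s) (leaves t)))

mapPB-∘ : ∀ {C : Set} (f : B → C) (g : A → B) t → mapPB f (mapPB g t) ≡ mapPB (f ∘ g) t
mapPB-∘ f g (atom a) = refl
mapPB-∘ f g (pand s t) = cong₂ pand (mapPB-∘ f g s) (mapPB-∘ f g t)
mapPB-∘ f g (por s t) = cong₂ por (mapPB-∘ f g s) (mapPB-∘ f g t)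

mapPB-cong : ∀ {f g : A → B} → (∀ a → f a ≡ g a) → ∀ t → mapPB f t ≡ mapPB g t
mapPB-cong e (atom a) = cong atom (e a)
mapPB-cong e (pand s t) = cong₂ pand (mapPB-cong e s) (mapPB-cong e t)
mapPB-cong e (por s t) = cong₂ por (mapPB-cong e s) (mapPB-cong e t)

mapPB-id : ∀ (t : PB A) → mapPB id t ≡ t
mapPB-id (atom a) = refl
mapPB-id (pand s t) = cong₂ pand (mapPB-id s) (mapPB-id t)
mapPB-id (por s t) = cong₂ por (mapPB-id s) (mapPB-id t)

allB-sound : ∀ (P : A → Bool) xs → T (allB P xs) → ∀ {x} → x ∈ xs → T (P x)
allB-sound P (y ∷ ys) h (here refl) = proj₁ (T-∧ .to h)
allB-sound P (y ∷ ys) h (there x∈) = allB-sound P ys (proj₂ (T-∧ .to h)) x∈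

eqStart-sound : ∀ s s′ → T (eqStart s s′) → s ≡ s′
eqStart-sound (num i) (num j) e = cong num (toWitness {a? = i ≟ j} e)
eqStart-sound star star _ = refl

eqLit-sound : ∀ (p q : Lit n) → T (eqLit p q) → p ≡ q
eqLit-sound (pos a) (pos b) e = cong pos (toWitness {a? = a ≟ᶠ b} e)
eqLit-sound (neg a) (neg b) e = cong neg (toWitness {a? = a ≟ᶠ b} e)

eqDur-sound : ∀ d d′ → T (eqDur d d′) → d ≡ d′
eqDur-sound cur cur _ = refl
eqDur-sound inf inf _ = refl
eqDur-sound ge ge _ = refl

eqPosLit-sound : ∀ (l l′ : PosLit n) → T (eqPosLit l l′) → prop l ≡ prop l′ × duration l ≡ duration l′
eqPosLit-sound l l′ e =
  let e-prop , e-rest = T-∧ .to e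
  in eqLit-sound (prop l) (prop l′) e-prop , eqDur-sound _ _ (proj₂ (T-∧ .to e-rest))

startIndex : PosLit n → ℕ
startIndex ⟨ _ , num i , _ ⟩ = i
startIndex ⟨ _ , star , _ ⟩ = 0

maxStart : PB (PosLit n) → ℕ
maxStart t = max 0 (List.map startIndex (leaves t))

startIndex≤maxStart : ∀ (t : PB (PosLit n)) {l} → l ∈ leaves t → startIndex l ≤ maxStart t
startIndex≤maxStart t l∈ = All.lookup (xs≤max 0 _) (∈-map⁺ startIndex l∈)

StartsAt : Start → PB (PosLit n) → Set
StartsAt s t = ∀ {l} → l ∈ leaves t → start l ≡ s

mapPB-StartsAt : ∀ {s} (g : PosLit n → PosLit n) → (∀ l → start (g l) ≡ s) → ∀ t → StartsAt s (mapPB g t)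
mapPB-StartsAt g st t l∈ with ∈-map⁻ g (subst (_ ∈_) (leaves-mapPB g t) l∈)
... | l′ , _ , refl = st l′

allSameStart-sound : ∀ (ls : List (PosLit n)) → T (allSameStart ls) → ∃ λ s → ∀ {l} → l ∈ ls → start l ≡ s
allSameStart-sound [] _ = star , λ ()
allSameStart-sound (l ∷ ls) same = start l , λ
  { (here refl) → refl
  ; (there l′∈) → sym (eqStart-sound _ _ (allB-sound _ ls same l′∈)) }

ofp-∨-StartsAt : ∀ (s t : PB (PosLit n)) → ∃ λ st →
  StartsAt st (if allSameStart (leaves s ++ leaves t) then por s t
               else por (mapPB starCur s) (mapPB starCur t))
ofp-∨-StartsAt s t with allSameStart (leaves s ++ leaves t) in same
... | false = star , [ mapPB-StartsAt starCur (λ _ → refl) s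
                     , mapPB-StartsAt starCur (λ _ → refl) t ] ∘ ∈-++⁻ (leaves (mapPB starCur s))
... | true = allSameStart-sound (leaves s ++ leaves t) (T-≡ .from same)

posLit-R : ∀ (l : PosLit n) → posLit tyR l ≡ l
posLit-R ⟨ _ , num _ , cur ⟩ = refl
posLit-R ⟨ _ , num _ , ge ⟩ = refl
posLit-R ⟨ _ , num _ , inf ⟩ = refl
posLit-R ⟨ _ , star , cur ⟩ = refl
posLit-R ⟨ _ , star , ge ⟩ = refl
posLit-R ⟨ _ , star , inf ⟩ = refl

posLit-G-X : ∀ (l : PosLit n) → posLit tyG (posLit tyX l) ≡ posLit tyX (posLit tyG l)
posLit-G-X ⟨ _ , num _ , cur ⟩ = refl
posLit-G-X ⟨ _ , num _ , ge ⟩ = refl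
posLit-G-X ⟨ _ , num _ , inf ⟩ = refl
posLit-G-X ⟨ _ , star , cur ⟩ = refl
posLit-G-X ⟨ _ , star , ge ⟩ = refl
posLit-G-X ⟨ _ , star , inf ⟩ = refl

posLit-G-G : ∀ (l : PosLit n) → posLit tyG (posLit tyG l) ≡ posLit tyG l
posLit-G-G ⟨ _ , num _ , cur ⟩ = refl
posLit-G-G ⟨ _ , num _ , ge ⟩ = refl
posLit-G-G ⟨ _ , num _ , inf ⟩ = refl
posLit-G-G ⟨ _ , star , cur ⟩ = refl
posLit-G-G ⟨ _ , star , ge ⟩ = refl
posLit-G-G ⟨ _ , star , inf ⟩ = refl

start-posLit-U : ∀ (l : PosLit n) → start (posLit tyU l) ≡ star
start-posLit-U ⟨ _ , num _ , cur ⟩ = refl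
start-posLit-U ⟨ _ , num _ , ge ⟩ = refl
start-posLit-U ⟨ _ , num _ , inf ⟩ = refl
start-posLit-U ⟨ _ , star , cur ⟩ = refl
start-posLit-U ⟨ _ , star , ge ⟩ = refl
start-posLit-U ⟨ _ , star , inf ⟩ = refl

Pos-R : ∀ (t : PB (PosLit n)) → Pos t tyR ≡ t
Pos-R t = trans (mapPB-cong posLit-R t) (mapPB-id t)

Pos-G-X : ∀ (t : PB (PosLit n)) → Pos (Pos t tyX) tyG ≡ Pos (Pos t tyG) tyX
Pos-G-X t = trans (mapPB-∘ _ _ t) (trans (mapPB-cong posLit-G-X t) (sym (mapPB-∘ _ _ t)))

Pos-G-G : ∀ (t : PB (PosLit n)) → Pos (Pos t tyG) tyG ≡ Pos t tyG
Pos-G-G t = trans (mapPB-∘ _ _ t) (mapPB-cong posLit-G-G t)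

satLit⇒evalLit : ∀ (w : Word n) {N} p → satLit w N p → evalLit (w N) p ≡ true
satLit⇒evalLit w (pos a) s = s
satLit⇒evalLit w (neg a) s = cong not s

projSet-true : ∀ (v : Fin n → Bool) keep (t : PB (PosLit n)) →
               ⟦ t ⟧ (λ l → T (keep l) → evalLit v (prop l) ≡ true) → evalP v (projSet t keep) ≡ true
projSet-true v keep (atom l) h with keep l
... | true = h _
... | false = refl
projSet-true v keep (pand s t) (hs , ht) = cong₂ _∧_ (projSet-true v keep s hs) (projSet-true v keep t ht)
projSet-true v keep (por s t) (inj₁ hs) = cong (_∨ _) (projSet-true v keep s hs)
projSet-true v keep (por s t) (inj₂ ht) = trans (cong (_ ∨_) (projSet-true v keep t ht)) (∨-zeroʳ _)

catch-up : ∀ b i N → ∃ λ k → b ≤ k × (b + i ≤ N → k + i ≡ N)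
catch-up b i N with b + i ≤? N
... | yes b+i≤N = N ∸ i , m+n≤o⇒m≤o∸n b b+i≤N , λ _ → m∸n+n≡m (m+n≤o⇒n≤o b b+i≤N)
... | no b+i≰N = b , ≤-refl , λ b+i≤N → ⊥-elim (b+i≰N b+i≤N)

release-now : ∀ {w : Word n} {k} φ ψ → Sat w k (lR φ ψ) → Sat w k ψ
release-now {k = k} _ _ s with s k ≤-refl
... | inj₁ sψ = sψ
... | inj₂ (j , k≤j , j<k , _) = ⊥-elim (<⇒≱ j<k k≤j)

NeverFrom : Word n → ℕ → Lit n → Set
NeverFrom w b p = ∀ m → b ≤ m → ¬ satLit w m p

NeverFrom-mono : ∀ {w : Word n} {b b′ p} → b ≤ b′ → NeverFrom w b p → NeverFrom w b′ p
NeverFrom-mono b≤b′ never m b′≤m = never m (≤-trans b≤b′ b′≤m)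

-- K is a cut-off position: literals that never hold from K on are the constructive stand-in for
-- literals holding only finitely often, which is what an inf-literal may ignore.
module Semantics {n} (w : Word n) (K : ℕ) where

  -- For a subformula satisfied at position b, the start i of a literal denotes position b + i.
  Due : (b N₀ N : ℕ) → PosLit n → Set
  Due b N₀ N ⟨ p , num i , cur ⟩ = N ≡ b + i
  Due b N₀ N ⟨ p , num i , ge ⟩ = b + i ≤ N
  Due b N₀ N ⟨ p , num i , inf ⟩ = b + i ≤ N ⊎ NeverFrom w K p
  Due b N₀ N ⟨ p , star , cur ⟩ = ⊥
  Due b N₀ N ⟨ p , star , ge ⟩ = N₀ ≤ N
  Due b N₀ N ⟨ p , star , inf ⟩ = NeverFrom w K p

  Required : (b N₀ N : ℕ) → PosLit n → Set
  Required b N₀ N l = Due b N₀ N l ⊎ NeverFrom w b (prop l)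

  Holds : (b N₀ N : ℕ) → PosLit n → Set
  Holds b N₀ N l = Required b N₀ N l → satLit w N (prop l)

  record Claim (b : ℕ) (t : PB (PosLit n)) : Set where
    constructor _,_
    field
      threshold : ℕ
      holds : ∀ N → ⟦ t ⟧ (Holds b threshold N)

  Due-antitone : ∀ {b N₀ N₀′ N} → N₀′ ≤ N₀ → ∀ l → Due b N₀ N l → Due b N₀′ N l
  Due-antitone le ⟨ _ , num _ , cur ⟩ = id
  Due-antitone le ⟨ _ , num _ , ge ⟩ = id
  Due-antitone le ⟨ _ , num _ , inf ⟩ = id
  Due-antitone le ⟨ _ , star , cur ⟩ = id
  Due-antitone le ⟨ _ , star , ge ⟩ = ≤-trans le
  Due-antitone le ⟨ _ , star , inf ⟩ = id

  inS⇒Due : ∀ t {N₀ N} l → l ∈ leaves t → T (inS l) → N₀ + maxStart t ≤ N → Due 0 N₀ N l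
  inS⇒Due t ⟨ _ , num _ , ge ⟩ l∈ _ late = ≤-trans (startIndex≤maxStart t l∈) (m+n≤o⇒n≤o _ late)
  inS⇒Due t ⟨ _ , star , ge ⟩ _ _ late = m+n≤o⇒m≤o _ late

  Due-inf : ∀ {b N₀ N} l → duration l ≡ inf → NeverFrom w K (prop l) → Due b N₀ N l
  Due-inf ⟨ _ , num _ , .inf ⟩ refl = inj₂
  Due-inf ⟨ _ , star , .inf ⟩ refl = id

  Holds-X : ∀ {b N₀ N} l → Holds (suc b) N₀ N l → Holds b N₀ N (posLit tyX l)
  Holds-X {b} ⟨ _ , num i , cur ⟩ h = h ∘ Sum.map (λ e → trans e (+-suc b i)) (NeverFrom-mono (n≤1+n b))
  Holds-X {b} {N = N} ⟨ _ , num i , ge ⟩ h =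
    h ∘ Sum.map (subst (_≤ N) (+-suc b i)) (NeverFrom-mono (n≤1+n b))
  Holds-X {b} {N = N} ⟨ _ , num i , inf ⟩ h =
    h ∘ Sum.map (Sum.map₁ (subst (_≤ N) (+-suc b i))) (NeverFrom-mono (n≤1+n b))
  Holds-X {b} ⟨ _ , star , cur ⟩ h = h ∘ Sum.map₂ (NeverFrom-mono (n≤1+n b))
  Holds-X {b} ⟨ _ , star , ge ⟩ h = h ∘ Sum.map₂ (NeverFrom-mono (n≤1+n b))
  Holds-X {b} ⟨ _ , star , inf ⟩ h = h ∘ Sum.map₂ (NeverFrom-mono (n≤1+n b))

  Holds-U : ∀ {b k N₀ N₀′ N} → b ≤ k → N₀′ ≤ N₀ → ∀ l → k + startIndex l ≤ N₀ →
            Holds k N₀′ N l → Holds b N₀ N (posLit tyU l)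
  Holds-U b≤k _ ⟨ _ , num _ , cur ⟩ _ h = h ∘ Sum.map ⊥-elim (NeverFrom-mono b≤k)
  Holds-U b≤k _ ⟨ _ , num _ , ge ⟩ bound h = h ∘ Sum.map (≤-trans bound) (NeverFrom-mono b≤k)
  Holds-U b≤k _ ⟨ _ , num _ , inf ⟩ _ h = h ∘ Sum.map inj₂ (NeverFrom-mono b≤k)
  Holds-U b≤k _ ⟨ _ , star , cur ⟩ _ h = h ∘ Sum.map₂ (NeverFrom-mono b≤k)
  Holds-U b≤k N₀′≤N₀ ⟨ _ , star , ge ⟩ _ h = h ∘ Sum.map (≤-trans N₀′≤N₀) (NeverFrom-mono b≤k)
  Holds-U b≤k _ ⟨ _ , star , inf ⟩ _ h = h ∘ Sum.map₂ (NeverFrom-mono b≤k)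

  Holds-G-num : ∀ {b k i N₀ N₀′ N} → b ≤ k → (b + i ≤ N → k + i ≡ N) → ∀ l → start l ≡ num i →
                Holds k N₀′ N l → Holds b N₀ N (posLit tyG l)
  Holds-G-num b≤k catch ⟨ _ , num _ , cur ⟩ refl h = h ∘ Sum.map (sym ∘ catch) (NeverFrom-mono b≤k)
  Holds-G-num b≤k catch ⟨ _ , num _ , ge ⟩ refl h = h ∘ Sum.map (≤-reflexive ∘ catch) (NeverFrom-mono b≤k)
  Holds-G-num b≤k catch ⟨ _ , num _ , inf ⟩ refl h =
    h ∘ Sum.map (Sum.map₁ (≤-reflexive ∘ catch)) (NeverFrom-mono b≤k)

  Holds-G-star : ∀ {b k N₀ N} → b ≤ k → K ≤ k → ∀ l → start l ≡ star →
                 Holds k N₀ N l → Holds b N₀ N (posLit tyG l)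
  Holds-G-star b≤k K≤k ⟨ _ , star , cur ⟩ refl h = h ∘ inj₂ ∘ [ NeverFrom-mono K≤k , NeverFrom-mono b≤k ]
  Holds-G-star b≤k K≤k ⟨ _ , star , ge ⟩ refl h = h ∘ Sum.map₂ (NeverFrom-mono b≤k)
  Holds-G-star b≤k K≤k ⟨ _ , star , inf ⟩ refl h = h ∘ Sum.map₂ (NeverFrom-mono b≤k)

  Claim-∧ : ∀ {b s t} → Claim b s → Claim b t → Claim b (pand s t)
  Claim-∧ {s = s} {t} (N₁ , hs) (N₂ , ht) =
    N₁ ⊔ N₂ , λ N → raise (m≤m⊔n N₁ N₂) s (hs N) , raise (m≤n⊔m N₁ N₂) t (ht N)
    where
    raise : ∀ {b N₀ N₀′ N} → N₀ ≤ N₀′ → ∀ t → ⟦ t ⟧ (Holds b N₀ N) → ⟦ t ⟧ (Holds b N₀′ N)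
    raise le t = ⟦⟧-mono t λ {l} _ h → h ∘ Sum.map₁ (Due-antitone le l)

  Claim-starCur : ∀ {b t} → Claim b t → Claim b (mapPB starCur t)
  Claim-starCur {t = t} (N₀ , h) =
    N₀ , λ N → ⟦⟧-mapPB starCur t (⟦⟧-mono t (λ _ h′ → h′ ∘ Sum.map₁ ⊥-elim) (h N))

  Claim-por : ∀ {b s t} → Claim b s ⊎ Claim b t → Claim b (por s t)
  Claim-por (inj₁ (N₀ , h)) = N₀ , inj₁ ∘ h
  Claim-por (inj₂ (N₀ , h)) = N₀ , inj₂ ∘ h

  Claim-∨ : ∀ {b} s t → Claim b s ⊎ Claim b t → ∀ c →
            Claim b (if c then por s t else por (mapPB starCur s) (mapPB starCur t))
  Claim-∨ s t c true = Claim-por c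
  Claim-∨ s t c false = Claim-por (Sum.map Claim-starCur Claim-starCur c)

  Claim-X : ∀ {b t} → Claim (suc b) t → Claim b (Pos t tyX)
  Claim-X {t = t} (N₀ , h) = N₀ , λ N → ⟦⟧-mapPB (posLit tyX) t (⟦⟧-mono t (λ {l} _ → Holds-X l) (h N))

  -- U turns ⟨p,i,≥⟩ into ⟨p,⋆,≥⟩, so the new threshold must pass k + i for every numbered start i of t.
  Claim-U : ∀ {b k t} → b ≤ k → Claim k t → Claim b (Pos t tyU)
  Claim-U {k = k} {t} b≤k (N₀ , h) = N₀ + (k + maxStart t) , λ N →
    ⟦⟧-mapPB (posLit tyU) t (⟦⟧-mono t (λ {l} l∈ → Holds-U b≤k (m≤m+n N₀ _) l (bound l∈)) (h N))
    where
    bound : ∀ {l} → l ∈ leaves t → k + startIndex l ≤ N₀ + (k + maxStart t)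
    bound l∈ = ≤-trans (+-monoʳ-≤ k (startIndex≤maxStart t l∈)) (m≤n+m _ N₀)

  -- Position N is served by the instance of t at k = N ∸ i.
  Claim-G-num : ∀ {b i t} → StartsAt (num i) t → (∀ k → b ≤ k → Claim k t) → Claim b (Pos t tyG)
  Claim-G-num {b} {i} {t} starts claim = 0 , λ N →
    let k , b≤k , catch = catch-up b i N
        N₀ , h = claim k b≤k
    in ⟦⟧-mapPB (posLit tyG) t (⟦⟧-mono t (λ {l} l∈ → Holds-G-num b≤k catch l (starts l∈)) (h N))

  Claim-G-star : ∀ {b t} → StartsAt star t → (∀ k → b ≤ k → Claim k t) → Claim b (Pos t tyG)
  Claim-G-star {b} {t} starts claim =
    let N₀ , h = claim (b + K) (m≤m+n b K)
    in N₀ , λ N → ⟦⟧-mapPB (posLit tyG) t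
                    (⟦⟧-mono t (λ {l} l∈ → Holds-G-star (m≤m+n b K) (m≤n+m K b) l (starts l∈)) (h N))

  Claim-G : ∀ {b s t} → StartsAt s t → (∀ k → b ≤ k → Claim k t) → Claim b (Pos t tyG)
  Claim-G {s = num i} = Claim-G-num
  Claim-G {s = star} = Claim-G-star

  Claim-ofp : ∀ {b} φ → Sat w b (embed φ) → Claim b (ofp φ)
  Claim-ofp-G : ∀ {b} ψ → (∀ k → b ≤ k → Sat w k (embed ψ)) → Claim b (Pos (ofp ψ) tyG)

  Claim-ofp {b} (lit p) s = 0 , λ N →
    [ (λ e → subst (λ m → satLit w m p) (sym (trans e (+-identityʳ b))) s)
    , (λ never → ⊥-elim (never b ≤-refl s)) ]
  Claim-ofp (φ₁ ∧ᶠ φ₂) (s₁ , s₂) = Claim-∧ (Claim-ofp φ₁ s₁) (Claim-ofp φ₂ s₂)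
  Claim-ofp (φ₁ ∨ᶠ φ₂) s = Claim-∨ (ofp φ₁) (ofp φ₂) (Sum.map (Claim-ofp φ₁) (Claim-ofp φ₂) s) _
  Claim-ofp (X φ) s = Claim-X (Claim-ofp φ s)
  Claim-ofp (G φ) s = Claim-ofp-G φ s
  Claim-ofp (U ψ φ) (k , b≤k , s , _) = Claim-U b≤k (Claim-ofp φ s)
  Claim-ofp {b} (R ψ φ) s =
    subst (Claim b) (sym (Pos-R (ofp φ))) (Claim-ofp φ (release-now ψ (embed φ) s))

  Claim-ofp-G (lit p) s = Claim-G (λ { (here refl) → refl }) λ k b≤k → Claim-ofp (lit p) (s k b≤k)
  Claim-ofp-G (φ₁ ∧ᶠ φ₂) s =
    Claim-∧ (Claim-ofp-G φ₁ λ k b≤k → proj₁ (s k b≤k)) (Claim-ofp-G φ₂ λ k b≤k → proj₂ (s k b≤k))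
  Claim-ofp-G (φ₁ ∨ᶠ φ₂) s =
    Claim-G (proj₂ (ofp-∨-StartsAt (ofp φ₁) (ofp φ₂))) λ k b≤k → Claim-ofp (φ₁ ∨ᶠ φ₂) (s k b≤k)
  Claim-ofp-G {b} (X ψ) s =
    subst (Claim b) (sym (Pos-G-X (ofp ψ))) (Claim-X (Claim-ofp-G ψ λ { (suc k) (s≤s b≤k) → s k b≤k }))
  Claim-ofp-G {b} (G ψ) s =
    subst (Claim b) (sym (Pos-G-G (ofp ψ))) (Claim-ofp-G ψ λ k b≤k → s k b≤k k ≤-refl)
  Claim-ofp-G (U ψ φ) s =
    Claim-G (mapPB-StartsAt (posLit tyU) start-posLit-U (ofp φ)) λ k b≤k → Claim-ofp (U ψ φ) (s k b≤k)
  Claim-ofp-G {b} (R ψ φ) s =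
    subst (λ t → Claim b (Pos t tyG)) (sym (Pos-R (ofp φ)))
      (Claim-ofp-G φ λ k b≤k → release-now ψ (embed φ) (s k b≤k))

  refute-at : ∀ t {N₀} N keep → ⟦ t ⟧ (Holds 0 N₀ N) → IsFF (projSet t keep) →
              (∀ {l} → l ∈ leaves t → T (keep l) → Required 0 N₀ N l ⊎ satLit w N (prop l)) → ⊥
  refute-at t {N₀} N keep holds ff kept =
    contradiction (trans (sym (projSet-true (w N) keep t (⟦⟧-mono t leaf holds))) (ff (w N))) λ ()
    where
    leaf : ∀ {l} → l ∈ leaves t → Holds 0 N₀ N l → T (keep l) → evalLit (w N) (prop l) ≡ true
    leaf {l} l∈ h k = satLit⇒evalLit w (prop l) ([ h , id ] (kept l∈ k))

Cond1⇒Unsatisfiable : ∀ (φ : Frag n) → Cond1 φ → Unsatisfiable (embed φ)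
Cond1⇒Unsatisfiable φ (_ , _ , i , _ , ff) (w , s) =
  refute-at (ofp φ) i (keepAt i) (holds i) ff λ {l} _ k → inj₁ (inj₁ (keepAt-Due l k))
  where
  open Semantics w 0
  open Claim (Claim-ofp φ s)

  keepAt-Due : ∀ l → T (keepAt i l) → Due 0 threshold i l
  keepAt-Due ⟨ _ , num j , d ⟩ k with j ≟ i | j <? i
  keepAt-Due ⟨ _ , num j , cur ⟩ k | yes refl | _ = refl
  keepAt-Due ⟨ _ , num j , ge ⟩ k | yes refl | _ = ≤-refl
  keepAt-Due ⟨ _ , num j , inf ⟩ k | yes refl | _ = inj₁ ≤-refl
  keepAt-Due ⟨ _ , num j , ge ⟩ k | no _ | yes j<i = <⇒≤ j<i

Cond2⇒Unsatisfiable : ∀ (φ : Frag n) → Cond2 φ → Unsatisfiable (embed φ)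
Cond2⇒Unsatisfiable φ ff (w , s) =
  refute-at (ofp φ) N inS (holds N) ff λ {l} l∈ is-ge → inj₁ (inj₁ (inS⇒Due (ofp φ) l l∈ is-ge ≤-refl))
  where
  open Semantics w 0
  open Claim (Claim-ofp φ s)
  N = threshold + maxStart (ofp φ)

Cond3⇒Unsatisfiable : ∀ (φ : Frag n) → Cond3 φ → Unsatisfiable (embed φ)
Cond3⇒Unsatisfiable {n} φ (l , _ , _ , S′ , S′-sound , ff) (w , s) =
  ¬¬-excluded-middle {A = ∃ λ m → satLit w m (prop l)} λ
    { (yes (m , l-at-m)) → refute-at (ofp φ) m keep (holds m) ff
        (kept-at m λ {l′} eq → inj₂ (subst (satLit w m) (sym (same-prop l′ eq)) l-at-m))
    ; (no never) → refute-at (ofp φ) 0 keep (holds 0) ff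
        (kept-at 0 λ {l′} eq → inj₁ (inj₂ λ m _ → never ∘ (m ,_) ∘ subst (satLit w m) (same-prop l′ eq))) }
  where
  open Semantics w 0
  open Claim (Claim-ofp φ s)

  keep : PosLit n → Bool
  keep l′ = S′ l′ ∨ eqPosLit l′ l

  same-prop : ∀ l′ → T (eqPosLit l′ l) → prop l′ ≡ prop l
  same-prop l′ = proj₁ ∘ eqPosLit-sound l′ l

  Due-ge-0 : ∀ {N} l′ → duration l′ ≡ ge → start l′ ≡ num 0 → Due 0 threshold N l′
  Due-ge-0 ⟨ _ , num .0 , .ge ⟩ refl refl = z≤n

  S′-Due : ∀ {N} l′ → T (S′ l′) → Due 0 threshold N l′
  S′-Due l′ k = let (_ , is-ge) , at-0 = S′-sound l′ (T-≡ .to k) in Due-ge-0 l′ is-ge at-0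

  kept-at : ∀ N → (∀ {l′} → T (eqPosLit l′ l) → Required 0 threshold N l′ ⊎ satLit w N (prop l′)) →
            ∀ {l′} → l′ ∈ leaves (ofp φ) → T (keep l′) → Required 0 threshold N l′ ⊎ satLit w N (prop l′)
  kept-at N matched {l′} _ = [ inj₁ ∘ inj₁ ∘ S′-Due l′ , matched {l′} ] ∘ T-∨ .to

Cond4⇒Unsatisfiable : ∀ (φ : Frag n) → Cond4 φ → Unsatisfiable (embed φ)
Cond4⇒Unsatisfiable {n} φ (l , _ , l-inf , ff) (w , s) =
  ¬¬-excluded-middle {A = ∃ λ K → NeverFrom w K (prop l)} λ
    { (yes (K , never)) → eventually-never K never
    ; (no often) → infinitely-often often }
  where
  keep : PosLit n → Bool
  keep l′ = inS l′ ∨ eqPosLit l′ l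

  eventually-never : ∀ K → NeverFrom w K (prop l) → ⊥
  eventually-never K never = refute-at (ofp φ) N keep (holds N) ff λ {l′} l′∈ →
    inj₁ ∘ inj₁ ∘ [ (λ is-ge → inS⇒Due (ofp φ) l′ l′∈ is-ge ≤-refl) , matched l′ ] ∘ T-∨ .to
    where
    open Semantics w K
    open Claim (Claim-ofp φ s)
    N = threshold + maxStart (ofp φ)

    matched : ∀ l′ → T (eqPosLit l′ l) → Due 0 threshold N l′
    matched l′ eq = let same-prop , same-dur = eqPosLit-sound l′ l eq
                    in Due-inf l′ (trans same-dur l-inf) (subst (NeverFrom w K) (sym same-prop) never)

  infinitely-often : ¬ (∃ λ K → NeverFrom w K (prop l)) → ⊥
  infinitely-often often =
    ¬¬-excluded-middle {A = ∃ λ m → M ≤ m × satLit w m (prop l)} λ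
      { (yes (m , M≤m , l-at-m)) → refute-at (ofp φ) m keep (holds m) ff λ {l′} l′∈ →
          [ (λ is-ge → inj₁ (inj₁ (inS⇒Due (ofp φ) l′ l′∈ is-ge M≤m)))
          , (λ eq → inj₂ (subst (satLit w m) (sym (proj₁ (eqPosLit-sound l′ l eq))) l-at-m)) ] ∘ T-∨ .to
      ; (no none) → often (M , λ m M≤m → none ∘ (m ,_) ∘ (M≤m ,_)) }
    where
    open Semantics w 0
    open Claim (Claim-ofp φ s)
    M = threshold + maxStart (ofp φ)

corollary1 : ∀ {n : ℕ} (φ : Frag n) →
    Cond1 φ ⊎ Cond2 φ ⊎ Cond3 φ ⊎ Cond4 φ → Unsatisfiable (embed φ)
corollary1 φ =
  [ Cond1⇒Unsatisfiable φ
  , [ Cond2⇒Unsatisfiable φ , [ Cond3⇒Unsatisfiable φ , Cond4⇒Unsatisfiable φ ] ] ]
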